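{- Let $n=2^s p_1^{\alpha_1}\cdots p_k^{\alpha_k}$ with $k\ge1$, $s\in\{0,1\}$, positive integers $\alpha_i$, and distinct primes $p_i\equiv1\pmod 4$. Then $G_n$ is not self-complementary (not isomorphic to its complement) unless $n$ is a prime.
   Context: The graph $G_n$ has vertex set $\mathbb{Z}_n$, and distinct $a,b$ are adjacent iff $a-b\equiv x^2\pmod n$ for some unit $x\in\mathbb{Z}_n^{\ast}$. -}

module Defs where

open import Data.Nat using (ℕ; zero; suc; _+_; _*_; _^_; _%_; _≤_; NonZero)
open import Data.Nat.Coprimality using (Coprime)
open import Data.Nat.Primality using (Prime)
open import Data.Fin using (Fin; toℕ)
open import Data.List using (List; []; _∷_; map; length)
open import Data.Nat.ListAction using (product)
open import Data.List.Relation.Unary.All using (All)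
open import Data.List.Relation.Unary.AllPairs using (AllPairs)
open import Data.Product using (Σ; ∃; _×_; _,_; proj₁; proj₂)
open import Function.Bundles using (_⤖_; Bijection; _⇔_)
open import Relation.Binary.PropositionalEquality using (_≡_; _≢_)
open import Relation.Nullary using (¬_)

IsUnit : (n : ℕ) → Fin n → Set
IsUnit n x = Coprime (toℕ x) n

-- a - b ≡ x² (mod n) for a, b, x ∈ ℤ_n, written without subtraction:
-- a ≡ b + x² (mod n)
DiffIsSq : (n : ℕ) → .{{NonZero n}} → Fin n → Fin n → Fin n → Set
DiffIsSq n a b x = toℕ a % n ≡ (toℕ b + toℕ x * toℕ x) % n

Adj : (n : ℕ) → .{{NonZero n}} → Fin n → Fin n → Set
Adj n a b = a ≢ b × ∃ λ (x : Fin n) → IsUnit n x × DiffIsSq n a b x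

CoAdj : (n : ℕ) → .{{NonZero n}} → Fin n → Fin n → Set
CoAdj n a b = a ≢ b × ¬ Adj n a b

SelfComplementary : (n : ℕ) → .{{NonZero n}} → Set
SelfComplementary n =
  Σ (Fin n ⤖ Fin n) λ f →
    ∀ a b → Adj n a b ⇔ CoAdj n (Bijection.to f a) (Bijection.to f b)

ppProduct : List (ℕ × ℕ) → ℕ
ppProduct fs = product (map (λ pa → proj₁ pa ^ proj₂ pa) fs)

GoodFactor : ℕ × ℕ → Set
GoodFactor (p , α) = Prime p × p % 4 ≡ 1 × 1 ≤ α

DistinctPrimes : List (ℕ × ℕ) → Set
DistinctPrimes fs = AllPairs (λ u v → proj₁ u ≢ proj₁ v) fs

{-# OPTIONS --safe #-}
-- If a − b ≡ x² with x a unit, then also a − b ≡ (−x)², and x ≢ −x once n > 2;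
-- conversely a unit x is a square root of a − b for at most one b.  Double
-- counting the pairs (b , x) gives 2 · deg a ≤ φ(n) for every vertex a.  An
-- isomorphism f from G_n to its complement turns the degree of a into the
-- codegree of f a, so deg a + deg (f a) = n − 1 and hence n − 1 ≤ φ(n), which
-- fails for composite n.  The hypotheses on the factorisation of n are only
-- needed to ensure n > 1.
module Submission where

open import Defs

open import Data.Fin using (Fin; zero; suc; toℕ; fromℕ<; _≟_)
open import Data.Fin.Properties using (any?; toℕ<n; toℕ-fromℕ<; toℕ-injective; suc-injective)
open import Data.List using (List; []; _∷_; length)
open import Data.List.Relation.Unary.All using (All; []; _∷_)
open import Data.Nat
  using (ℕ; zero; suc; _+_; _*_; _∸_; _^_; _%_; _≤_; _<_; z≤n; s≤s; NonZero; NonTrivial;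
         >-nonZero⁻¹; nonTrivial⇒≢1; nonTrivial⇒n>1; n>1⇒nonTrivial)
  renaming (_≟_ to _≟ℕ_)
open import Data.Nat.Coprimality using (Coprime; coprime?; ¬0-coprimeTo-2+)
open import Data.Nat.DivMod using (%-distribˡ-+; [m+kn]%n≡m%n; m<n⇒m%n≡m)
open import Data.Nat.Divisibility using (_∣_; divides; ∣-refl; ∣m+n∣m⇒∣n)
open import Data.Nat.Primality
  using (Prime; prime?; composite; ¬prime⇒composite; prime[2]; prime⇒nonZero; prime⇒nonTrivial)
open import Data.Nat.Properties hiding (_≟_; suc-injective)
open import Algebra.Properties.CommutativeMonoid.Sum +-0-commutativeMonoid
  using (sum; sum-cong-≗; ∑-distrib-+; ∑-comm; ∑-permute)
open import Data.Nat.Tactic.RingSolver using (solve-∀)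
open import Data.Product using (_×_; _,_; proj₁; proj₂; ∃; ∃₂)
open import Data.Sum using (inj₁; inj₂)
open import Function using (_∘_)
open import Function.Bundles using (_⤖_; _⇔_; Bijection; Equivalence)
open import Function.Properties.Bijection using (⤖⇒↔)
open import Relation.Binary.PropositionalEquality
open import Relation.Nullary using (Dec; yes; no; ¬_; ¬?; _×-dec_; contradiction)
open import Relation.Unary using (Decidable)
open import Relation.Unary.Properties using (∁?)

private
  variable
    m k : ℕ
    A B : Set

𝟙 : Dec A → ℕ
𝟙 (yes _) = 1
𝟙 (no _)  = 0

𝟙-yes : (d : Dec A) → A → 𝟙 d ≡ 1
𝟙-yes (yes _) _ = refl
𝟙-yes (no ¬a) a = contradiction a ¬a

𝟙-no : (d : Dec A) → ¬ A → 𝟙 d ≡ 0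
𝟙-no (yes a) ¬a = contradiction a ¬a
𝟙-no (no _)  _  = refl

𝟙-cong : A ⇔ B → (d : Dec A) (e : Dec B) → 𝟙 d ≡ 𝟙 e
𝟙-cong A⇔B (yes a) e = sym (𝟙-yes e (Equivalence.to A⇔B a))
𝟙-cong A⇔B (no ¬a) e = sym (𝟙-no e (¬a ∘ Equivalence.from A⇔B))

𝟙-¬ : (d : Dec A) → 𝟙 d + 𝟙 (¬? d) ≡ 1
𝟙-¬ (yes _) = refl
𝟙-¬ (no _)  = refl

𝟙-split : (A → B) → (d : Dec A) (e : Dec B) (f : Dec (B × ¬ A)) → 𝟙 d + 𝟙 f ≡ 𝟙 e
𝟙-split A⇒B (yes a) (yes _) f = cong suc (𝟙-no f λ (_ , ¬a) → ¬a a)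
𝟙-split A⇒B (yes a) (no ¬b) f = contradiction (A⇒B a) ¬b
𝟙-split A⇒B (no ¬a) (yes b) f = 𝟙-yes f (b , ¬a)
𝟙-split A⇒B (no ¬a) (no ¬b) f = 𝟙-no f (¬b ∘ proj₁)

sum-mono-≤ : {f g : Fin m → ℕ} → (∀ i → f i ≤ g i) → sum f ≤ sum g
sum-mono-≤ {zero}  f≤g = z≤n
sum-mono-≤ {suc m} f≤g = +-mono-≤ (f≤g zero) (sum-mono-≤ (f≤g ∘ suc))

sum-1 : sum {m} (λ _ → 1) ≡ m
sum-1 {zero}  = refl
sum-1 {suc m} = cong suc sum-1

count : {P : Fin m → Set} → Decidable P → ℕ
count P? = sum (λ i → 𝟙 (P? i))

module _ {P : Fin m → Set} (P? : Decidable P) where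

  count-cong : {Q : Fin m → Set} (Q? : Decidable Q) → (∀ i → P i ⇔ Q i) → count P? ≡ count Q?
  count-cong Q? P⇔Q = sum-cong-≗ (λ i → 𝟙-cong (P⇔Q i) (P? i) (Q? i))

  count-permute : (π : Fin m ⤖ Fin m) → count (P? ∘ Bijection.to π) ≡ count P?
  count-permute π = sym (∑-permute (λ i → 𝟙 (P? i)) (⤖⇒↔ π))

  count-complement : count P? + count (∁? P?) ≡ m
  count-complement = begin
    count P? + count (∁? P?)           ≡⟨ ∑-distrib-+ (λ i → 𝟙 (P? i)) (λ i → 𝟙 (∁? P? i)) ⟨
    sum (λ i → 𝟙 (P? i) + 𝟙 (¬? (P? i))) ≡⟨ sum-cong-≗ (λ i → 𝟙-¬ (P? i)) ⟩
    sum {m} (λ _ → 1)                  ≡⟨ sum-1 ⟩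
    m                                  ∎
    where open ≡-Reasoning

  count-split : {Q : Fin m → Set} (Q? : Decidable Q) → (∀ {i} → P i → Q i) →
                (R? : Decidable (λ i → Q i × ¬ P i)) → count P? + count R? ≡ count Q?
  count-split Q? P⇒Q R? = begin
    count P? + count R?               ≡⟨ ∑-distrib-+ (λ i → 𝟙 (P? i)) (λ i → 𝟙 (R? i)) ⟨
    sum (λ i → 𝟙 (P? i) + 𝟙 (R? i)) ≡⟨ sum-cong-≗ (λ i → 𝟙-split P⇒Q (P? i) (Q? i) (R? i)) ⟩
    count Q?                          ∎
    where open ≡-Reasoning

count-none : {P : Fin m → Set} (P? : Decidable P) → (∀ i → ¬ P i) → count P? ≡ 0
count-none {zero}  P? ¬P = refl
count-none {suc m} P? ¬P = cong₂ _+_ (𝟙-no (P? zero) (¬P zero)) (count-none (P? ∘ suc) (¬P ∘ suc))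

count≤1 : {P : Fin m → Set} (P? : Decidable P) → (∀ {i j} → P i → P j → i ≡ j) → count P? ≤ 1
count≤1 {zero}  P? unique = z≤n
count≤1 {suc m} P? unique with P? zero
... | yes p = ≤-reflexive (cong suc (count-none (P? ∘ suc) λ i q → 0≢suc (unique p q)))
  where
  0≢suc : ∀ {i : Fin m} → zero ≢ suc i
  0≢suc ()
... | no _  = count≤1 (P? ∘ suc) λ p q → suc-injective (unique p q)

count≥1 : {P : Fin m → Set} (P? : Decidable P) {i : Fin m} → P i → 1 ≤ count P?
count≥1 P? {zero}  p = ≤-trans (≤-reflexive (sym (𝟙-yes (P? zero) p))) (m≤m+n _ _)
count≥1 P? {suc i} p = ≤-trans (count≥1 (P? ∘ suc) p) (m≤n+m _ _)

count≥2 : {P : Fin m → Set} (P? : Decidable P) {i j : Fin m} → i ≢ j → P i → P j → 2 ≤ count P?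
count≥2 P? {zero}  {zero}  i≢j _  _  = contradiction refl i≢j
count≥2 P? {zero}  {suc _} _   pi pj = +-mono-≤ (≤-reflexive (sym (𝟙-yes (P? zero) pi))) (count≥1 (P? ∘ suc) pj)
count≥2 P? {suc _} {zero}  _   pi pj = +-mono-≤ (≤-reflexive (sym (𝟙-yes (P? zero) pj))) (count≥1 (P? ∘ suc) pi)
count≥2 P? {suc _} {suc _} i≢j pi pj = ≤-trans (count≥2 (P? ∘ suc) (i≢j ∘ cong suc) pi pj) (m≤n+m _ _)

count-≡ : (a : Fin m) → count (a ≟_) ≡ 1
count-≡ a = ≤-antisym (count≤1 (a ≟_) λ a≡i a≡j → trans (sym a≡i) a≡j) (count≥1 (a ≟_) refl)

-- Double counting of the pairs (i , j) with R i j.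
count+count≤count : {P : Fin m → Set} {Q : Fin k → Set} {R : Fin m → Fin k → Set}
  (P? : Decidable P) (Q? : Decidable Q) (R? : ∀ i → Decidable (R i)) →
  (∀ {i} → P i → ∃₂ λ j j' → j ≢ j' × R i j × R i j') →
  (∀ {i i' j} → R i j → R i' j → i ≡ i') →
  (∀ {i j} → R i j → Q j) →
  count P? + count P? ≤ count Q?
count+count≤count P? Q? R? twoPartners unique R⇒Q = begin
  count P? + count P?                        ≡⟨ ∑-distrib-+ (λ i → 𝟙 (P? i)) (λ i → 𝟙 (P? i)) ⟨
  sum (λ i → 𝟙 (P? i) + 𝟙 (P? i))          ≤⟨ sum-mono-≤ partners ⟩
  sum (λ i → count (R? i))                   ≡⟨ ∑-comm (λ i j → 𝟙 (R? i j)) ⟩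
  sum (λ j → count (λ i → R? i j))           ≤⟨ sum-mono-≤ owners ⟩
  count Q?                                   ∎
  where
  open ≤-Reasoning
  partners : ∀ i → 𝟙 (P? i) + 𝟙 (P? i) ≤ count (R? i)
  partners i with P? i
  ... | yes p = let (j , j' , j≢j' , r , r') = twoPartners p in count≥2 (R? i) j≢j' r r'
  ... | no _  = z≤n
  owners : ∀ j → count (λ i → R? i j) ≤ 𝟙 (Q? j)
  owners j with Q? j
  ... | yes _ = count≤1 (λ i → R? i j) unique
  ... | no ¬q = ≤-reflexive (count-none (λ i → R? i j) λ i r → ¬q (R⇒Q r))

m+m≤o⇒n+n≤o⇒m+n≤o : ∀ {m n o} → m + m ≤ o → n + n ≤ o → m + n ≤ o
m+m≤o⇒n+n≤o⇒m+n≤o {m} {n} m+m≤o n+n≤o with ≤-total m n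
... | inj₁ m≤n = ≤-trans (+-monoˡ-≤ n m≤n) n+n≤o
... | inj₂ n≤m = ≤-trans (+-monoʳ-≤ m n≤m) m+m≤o

module _ {n : ℕ} .{{_ : NonZero n}} where

  %-cong-+ʳ : ∀ {a b} c → a % n ≡ b % n → (a + c) % n ≡ (b + c) % n
  %-cong-+ʳ {a} {b} c a≡b = begin
    (a + c) % n           ≡⟨ %-distribˡ-+ a c n ⟩
    (a % n + c % n) % n   ≡⟨ cong (λ r → (r + c % n) % n) a≡b ⟩
    (b % n + c % n) % n   ≡⟨ %-distribˡ-+ b c n ⟨
    (b + c) % n           ∎
    where open ≡-Reasoning

  -- Adding c · n ∸ c (exact, as c ≤ c · n) turns c into a multiple of n.
  %-cancel-+ʳ : ∀ a b c → (a + c) % n ≡ (b + c) % n → a % n ≡ b % n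
  %-cancel-+ʳ a b c eq = begin
    a % n                     ≡⟨ [m+kn]%n≡m%n a c n ⟨
    (a + c * n) % n           ≡⟨ cong (_% n) (add-c*n∸c a) ⟨
    (a + c + (c * n ∸ c)) % n ≡⟨ %-cong-+ʳ (c * n ∸ c) eq ⟩
    (b + c + (c * n ∸ c)) % n ≡⟨ cong (_% n) (add-c*n∸c b) ⟩
    (b + c * n) % n           ≡⟨ [m+kn]%n≡m%n b c n ⟩
    b % n                     ∎
    where
    open ≡-Reasoning
    add-c*n∸c : ∀ x → x + c + (c * n ∸ c) ≡ x + c * n
    add-c*n∸c x = trans (+-assoc x c _) (cong (x +_) (m+[n∸m]≡n (m≤m*n c n)))

  %-square-complement : ∀ b {x y} → x + y ≡ n → (b + x * x) % n ≡ (b + y * y) % n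
  %-square-complement b {x} {y} x+y≡n = begin
    (b + x * x) % n           ≡⟨ [m+kn]%n≡m%n (b + x * x) y n ⟨
    (b + x * x + y * n) % n   ≡⟨ cong (_% n) (subst (λ n → b + x * x + y * n ≡ b + y * y + x * n) x+y≡n
                                                    (swap-squares b x y)) ⟩
    (b + y * y + x * n) % n   ≡⟨ [m+kn]%n≡m%n (b + y * y) x n ⟩
    (b + y * y) % n           ∎
    where
    open ≡-Reasoning
    swap-squares : ∀ b x y → b + x * x + y * (x + y) ≡ b + y * y + x * (x + y)
    swap-squares = solve-∀

coprime-complement : ∀ {x y n} → x + y ≡ n → Coprime x n → Coprime y n
coprime-complement {x} {y} x+y≡n coprime (d∣y , d∣n) =
  coprime (∣m+n∣m⇒∣n (subst (_ ∣_) (trans (sym x+y≡n) (+-comm x y)) d∣n) d∣y , d∣n)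

coprime-half : ∀ {x n} → x + x ≡ n → Coprime x n → n ≡ 2
coprime-half {x} {n} x+x≡n coprime = begin
  n      ≡⟨ x+x≡n ⟨
  x + x  ≡⟨ cong (λ x → x + x) (coprime (∣-refl , divides 2 (trans (sym x+x≡n) x+x≡2*x))) ⟩
  2      ∎
  where
  open ≡-Reasoning
  x+x≡2*x : x + x ≡ 2 * x
  x+x≡2*x = cong (x +_) (sym (+-identityʳ x))

unit? : (n : ℕ) → Decidable (IsUnit n)
unit? n x = coprime? (toℕ x) n

totient : ℕ → ℕ
totient n = count (unit? n)

-- 0 and a proper divisor of n are two non-units.
totient+2≤n : ∀ {n} .{{_ : NonTrivial n}} → ¬ Prime n → totient n + 2 ≤ n
totient+2≤n {n} ¬prime with ¬prime⇒composite ¬prime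
... | composite {d} d<n d∣n = begin
  totient n + 2                           ≤⟨ +-monoʳ-≤ (totient n) two-non-units ⟩
  totient n + count (∁? (unit? n))        ≡⟨ count-complement (unit? n) ⟩
  n                                       ∎
  where
  open ≤-Reasoning
  0<n : 0 < n
  0<n = <-trans (s≤s z≤n) (nonTrivial⇒n>1 n)
  two-non-units : 2 ≤ count (∁? (unit? n))
  two-non-units = count≥2 (∁? (unit? n)) 0≢d
    (λ unit → ¬0-coprimeTo-2+ (subst (λ z → Coprime z n) (toℕ-fromℕ< 0<n) unit))
    (λ unit → nonTrivial⇒≢1 (unit (subst (d ∣_) (sym (toℕ-fromℕ< d<n)) ∣-refl , d∣n)))
    where
    0≢d : fromℕ< 0<n ≢ fromℕ< d<n
    0≢d eq = <⇒≢ (<-trans (s≤s z≤n) (nonTrivial⇒n>1 d))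
                 (trans (sym (toℕ-fromℕ< 0<n)) (trans (cong toℕ eq) (toℕ-fromℕ< d<n)))

module G (n : ℕ) .{{_ : NonZero n}} where

  UnitRoot : Fin n → Fin n → Fin n → Set
  UnitRoot a b x = IsUnit n x × DiffIsSq n a b x

  unitRoot? : ∀ a b → Decidable (UnitRoot a b)
  unitRoot? a b x = unit? n x ×-dec (toℕ a % n ≟ℕ (toℕ b + toℕ x * toℕ x) % n)

  adj? : ∀ a → Decidable (Adj n a)
  adj? a b = ¬? (a ≟ b) ×-dec any? (unitRoot? a b)

  coAdj? : ∀ a → Decidable (CoAdj n a)
  coAdj? a b = ¬? (a ≟ b) ×-dec ¬? (adj? a b)

  degree coDegree : Fin n → ℕ
  degree a   = count (adj? a)
  coDegree a = count (coAdj? a)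

  degree+coDegree+1≡n : ∀ a → degree a + coDegree a + 1 ≡ n
  degree+coDegree+1≡n a = begin
    degree a + coDegree a + 1             ≡⟨ cong₂ _+_ (count-split (adj? a) (∁? (a ≟_)) proj₁ (coAdj? a))
                                                       (sym (count-≡ a)) ⟩
    count (∁? (a ≟_)) + count (a ≟_)      ≡⟨ +-comm _ (count (a ≟_)) ⟩
    count (a ≟_) + count (∁? (a ≟_))      ≡⟨ count-complement (a ≟_) ⟩
    n                                     ∎
    where open ≡-Reasoning

  unitRoot-injective : ∀ {a b b' x} → UnitRoot a b x → UnitRoot a b' x → b ≡ b'
  unitRoot-injective {a} {b} {b'} {x} (_ , a≡b+x²) (_ , a≡b'+x²) = toℕ-injective (begin
    toℕ b      ≡⟨ m<n⇒m%n≡m (toℕ<n b) ⟨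
    toℕ b % n  ≡⟨ %-cancel-+ʳ (toℕ b) (toℕ b') (toℕ x * toℕ x) (trans (sym a≡b+x²) a≡b'+x²) ⟩
    toℕ b' % n ≡⟨ m<n⇒m%n≡m (toℕ<n b') ⟩
    toℕ b'     ∎)
    where open ≡-Reasoning

  negate : (x : Fin n) → toℕ x ≢ 0 → ∃ λ x' → toℕ x + toℕ x' ≡ n
  negate x x≢0 = fromℕ< n∸x<n , trans (cong (toℕ x +_) (toℕ-fromℕ< n∸x<n)) (m+[n∸m]≡n x≤n)
    where
    x≤n = <⇒≤ (toℕ<n x)
    n∸x<n = ∸-monoʳ-< (n≢0⇒n>0 x≢0) x≤n

  two-unitRoots : 2 < n → ∀ {a b} → Adj n a b → ∃₂ λ x x' → x ≢ x' × UnitRoot a b x × UnitRoot a b x'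
  two-unitRoots 2<n {a} {b} (_ , x , unit , a≡b+x²) =
    x , x' , x≢x' , (unit , a≡b+x²) , (coprime-complement x+x'≡n unit , a≡b+x'²)
    where
    instance
      _ : NonTrivial n
      _ = n>1⇒nonTrivial (<-trans (s≤s (s≤s z≤n)) 2<n)
    x≢0 : toℕ x ≢ 0
    x≢0 x≡0 = ¬0-coprimeTo-2+ (subst (λ z → Coprime z n) x≡0 unit)
    x' = proj₁ (negate x x≢0)
    x+x'≡n = proj₂ (negate x x≢0)
    a≡b+x'² : DiffIsSq n a b x'
    a≡b+x'² = trans a≡b+x² (%-square-complement (toℕ b) {toℕ x} {toℕ x'} x+x'≡n)
    x≢x' : x ≢ x'
    x≢x' x≡x' = <⇒≢ 2<n (sym (coprime-half (subst (λ z → toℕ x + toℕ z ≡ n) (sym x≡x') x+x'≡n) unit))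

  degree+degree≤totient : 2 < n → ∀ a → degree a + degree a ≤ totient n
  degree+degree≤totient 2<n a =
    count+count≤count (adj? a) (unit? n) (unitRoot? a) (two-unitRoots 2<n) unitRoot-injective proj₁

  selfComplementary⇒degree≡coDegree : ((f , _) : SelfComplementary n) →
                                      ∀ a → degree a ≡ coDegree (Bijection.to f a)
  selfComplementary⇒degree≡coDegree (f , iso) a = trans
    (count-cong (adj? a) (coAdj? (to a) ∘ to) (iso a))
    (count-permute (coAdj? (to a)) f)
    where to = Bijection.to f

  selfComplementary⇒n≤totient+1 : 2 < n → SelfComplementary n → n ≤ totient n + 1
  selfComplementary⇒n≤totient+1 2<n sc@(f , _) = begin
    n                             ≡⟨ degree+coDegree+1≡n b ⟨
    degree b + coDegree b + 1     ≡⟨ cong (λ d → degree b + d + 1) (selfComplementary⇒degree≡coDegree sc a) ⟨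
    degree b + degree a + 1       ≤⟨ +-monoˡ-≤ 1 (m+m≤o⇒n+n≤o⇒m+n≤o {degree b} {degree a}
                                                     (degree+degree≤totient 2<n b)
                                                     (degree+degree≤totient 2<n a)) ⟩
    totient n + 1                 ∎
    where
    open ≤-Reasoning
    a = fromℕ< (>-nonZero⁻¹ n)
    b = Bijection.to f a

selfComplementary⇒prime : ∀ n .{{_ : NonZero n}} → 1 < n → SelfComplementary n → Prime n
selfComplementary⇒prime n 1<n sc with m≤n⇒m<n∨m≡n 1<n
... | inj₂ refl = prime[2]
... | inj₁ 2<n with prime? n
...   | yes p = p
...   | no ¬prime = contradiction (+-cancelˡ-≤ (totient n) 2 1 φ+2≤φ+1) λ { (s≤s ()) }
  where
  instance
    _ : NonTrivial n
    _ = n>1⇒nonTrivial 1<n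
  φ+2≤φ+1 : totient n + 2 ≤ totient n + 1
  φ+2≤φ+1 = ≤-trans (totient+2≤n ¬prime) (G.selfComplementary⇒n≤totient+1 n 2<n sc)

ppProduct-pos : ∀ fs → All GoodFactor fs → 0 < ppProduct fs
ppProduct-pos []             []                   = s≤s z≤n
ppProduct-pos ((p , α) ∷ fs) ((p-prime , _) ∷ good) =
  *-mono-≤ (m^n>0 p {{prime⇒nonZero p-prime}} α) (ppProduct-pos fs good)

ppProduct>1 : ∀ fs → 1 ≤ length fs → All GoodFactor fs → 1 < ppProduct fs
ppProduct>1 ((p , α) ∷ fs) _ ((p-prime , _ , 1≤α) ∷ good) =
  *-mono-≤ (^-monoʳ-< p (nonTrivial⇒n>1 p {{prime⇒nonTrivial p-prime}}) 1≤α) (ppProduct-pos fs good)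

proposition3p2 : (n s : ℕ) (fs : List (ℕ × ℕ)) .{{_ : NonZero n}} →
    1 ≤ length fs → s ≤ 1 → All GoodFactor fs → DistinctPrimes fs →
    n ≡ 2 ^ s * ppProduct fs →
    SelfComplementary n → Prime n
proposition3p2 n s fs nonempty _ good _ n≡2^s*pp =
  selfComplementary⇒prime n (begin-strict
    1                      <⟨ ppProduct>1 fs nonempty good ⟩
    ppProduct fs           ≤⟨ m≤n*m (ppProduct fs) (2 ^ s) {{m^n≢0 2 s}} ⟩
    2 ^ s * ppProduct fs   ≡⟨ n≡2^s*pp ⟨
    n                      ∎)
  where open ≤-Reasoning
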